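{- Let $k>2$ and let $\sigma\in\mathfrak{S}_n$. Suppose that $\sigma$ is not equivalent to any $w_0^{(k,i)}$, and that $\sigma$ is not covered (in the right weak order) by any permutation equivalent to some $w_0^{(k,i)}$. The permutations covered by $\sigma$ are $\{\sigma s_j : j\in \mathrm{Des}(\sigma)\}$. Then there is at most one $j\in\mathrm{Des}(\sigma)$ such that $\sigma s_j$ is equivalent to $w_0^{(k,i)}$ for some $i$.
   Context: $\mathfrak{S}_n$ is the symmetric group on $[n]=\{1,\dots,n\}$, with simple transpositions $s_i=(i\ i+1)$, $1\le i\le n-1$. For $\sigma\in\mathfrak{S}_n$, $\ell(\sigma)$ is its number of inversions (equal to the minimal number of simple transpositions whose product is $\sigma$), and $\mathrm{Des}(\sigma)=\{i : \sigma(i)>\sigma(i+1)\}$. In the right weak order, $\tau$ is covered by $\sigma$ iff $\sigma=\tau s_i$ with $\ell(\sigma)=\ell(\tau)+1$; equivalently $\tau=\sigma s_i$ with $i\in\mathrm{Des}(\sigma)$. For $1\le k$ and $i+k-1\le n$, $w_0^{(k,i)}\in\mathfrak{S}_n$ is the permutation fixing every $j<i$ and every $j\ge i+k$, and sending $i+r\mapsto i+k-1-r$ for $0\le r\le k-1$ (it reverses the block of positions $i,\dots,i+k-1$; its descent set is $\{i,\dots,i+k-2\}$). Two permutations $\sigma,\tau$ with $\ell(\sigma)=\ell(\tau)=l$ are called equivalent if there are reduced decompositions $\sigma=s_{i_1}\cdots s_{i_l}$ and $\tau=s_{j_1}\cdots s_{j_l}$ with $i_a-i_{a+1}=j_a-j_{a+1}$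 for all $1\le a<l$. -}

module Defs where

open import Data.Nat as ℕ using (ℕ; zero; suc; _+_; _∸_; _≤_; pred)
open import Data.Fin as F using (Fin; toℕ; fromℕ<; inject₁)
open import Data.Fin.Properties using (_<?_)
open import Data.Fin.Permutation.Components using (transpose)
open import Data.Integer as ℤ using (ℤ; +_; _-_)
open import Data.List using (List; []; _∷_; length; map; filter; concatMap; allFin)
open import Data.Product using (Σ; ∃; _×_; _,_; proj₁; proj₂)
open import Relation.Nullary using (yes; no; ¬_)
open import Relation.Nullary.Decidable using (_×-dec_)
open import Relation.Binary.PropositionalEquality using (_≡_)

-- Permutations of [n] in one-line notation: functions Fin n → Fin n
-- (positions / values are 0-based: Fin n = {0,…,n-1} stands for [n]).
Fun : ℕ → Set
Fun n = Fin n → Fin n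

IsPerm : ∀ {n} → Fun n → Set
IsPerm {n} σ = ((x y : Fin n) → σ x ≡ σ y → x ≡ y) × ((y : Fin n) → ∃ λ x → σ x ≡ y)

_≈_ : ∀ {n} → Fun n → Fun n → Set
_≈_ {n} σ τ = (x : Fin n) → σ x ≡ τ x

_·_ : ∀ {n} → Fun n → Fun n → Fun n
(σ · τ) x = σ (τ x)

-- Letters: a simple transposition index j : Fin (pred n) stands for s_{j+1},
-- swapping (0-based) positions j and j+1.
Letter : ℕ → Set
Letter n = Fin (pred n)

lo : ∀ {n} → Letter n → Fin n
lo {suc m} j = inject₁ j

hi : ∀ {n} → Letter n → Fin n
hi {suc m} j = F.suc j

s : ∀ {n} → Letter n → Fun n
s j = transpose (lo j) (hi j)

prod : ∀ {n} → List (Letter n) → Fun n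
prod [] x = x
prod (i ∷ w) x = s i (prod w x)

pairs : (n : ℕ) → List (Fin n × Fin n)
pairs n = concatMap (λ a → map (λ b → (a , b)) (allFin n)) (allFin n)

ℓ : ∀ {n} → Fun n → ℕ
ℓ {n} σ = length (filter (λ p → (proj₁ p <? proj₂ p) ×-dec (σ (proj₂ p) <? σ (proj₁ p))) (pairs n))

Des : ∀ {n} → Fun n → Letter n → Set
Des σ j = σ (hi j) F.< σ (lo j)

ReducedDecomp : ∀ {n} → List (Letter n) → Fun n → Set
ReducedDecomp w σ = (prod w ≈ σ) × (length w ≡ ℓ σ)

diffs : List ℕ → List ℤ
diffs (a ∷ b ∷ rest) = ((+ a) - (+ b)) ∷ diffs (b ∷ rest)
diffs _ = []

Equivalent : ∀ {n} → Fun n → Fun n → Set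
Equivalent {n} σ τ =
  (ℓ σ ≡ ℓ τ) ×
  (Σ (List (Letter n)) λ u → Σ (List (Letter n)) λ v →
     ReducedDecomp u σ × ReducedDecomp v τ ×
     (diffs (map toℕ u) ≡ diffs (map toℕ v)))

CoveredBy : ∀ {n} → Fun n → Fun n → Set
CoveredBy {n} τ σ = ∃ λ (j : Letter n) → (σ ≈ (τ · s j)) × (ℓ σ ≡ suc (ℓ τ))

-- w₀^{(k,i)} with 0-based i (block of positions i,…,i+k-1 reversed);
-- meaningful when 1 ≤ k and i + k ≤ n.
w0 : ∀ {n} → ℕ → ℕ → Fun n
w0 {n} k i x with i ℕ.≤? toℕ x | toℕ x ℕ.<? i + k
... | yes _ | yes _ with (i + (k ∸ 1) ∸ (toℕ x ∸ i)) ℕ.<? n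
...   | yes p = fromℕ< p
...   | no _ = x
w0 k i x | _ | _ = x

EquivSomeW0 : ∀ {n} → ℕ → Fun n → Set
EquivSomeW0 {n} k σ = ∃ λ i → (i + k ≤ n) × Equivalent σ (w0 {n} k i)

-- Extend a permutation of {0, …, n-1} by the identity to a bijection of ℤ.
-- Equal consecutive differences make two words translates of each other, so a
-- permutation equivalent to w₀^{(k,i)} is the reversal R_p of a block
-- [p, p+k-1] of ℤ.  If σ s_j = R_p and σ s_j′ = R_q, then R_p s_j = R_q s_j′;
-- for p = q this gives j = j′.  For p < q, R_p R_q = s_j s_j′ raises p by
-- k-1 ≥ 2, which a product of two adjacent transpositions does only as
-- s_{p+1} s_p, so j = p+1; likewise R_q R_p = s_j′ s_j lowers q+k-1 to q, so
-- j+1 = q+k-1.  Then q+k-1 = p+2, impossible since q > p and k ≥ 3.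

module Submission where

open import Defs
open import Data.Nat as ℕ using (ℕ; zero; suc; _∸_; s≤s; z≤n)
import Data.Nat.Properties as ℕP
open import Data.Integer as ℤ using (ℤ; +_; -[1+_]; _+_; _-_; -_; 0ℤ; 1ℤ; _≤_; _<_)
import Data.Integer.Properties as ℤP
open import Data.Integer.Tactic.RingSolver using (solve-∀)
open import Algebra.Properties.AbelianGroup ℤP.+-0-abelianGroup using (∙-cancelˡ)
open import Data.Fin as F using (Fin; toℕ; fromℕ<; inject₁)
import Data.Fin.Properties as FP
open import Data.List using (List; []; _∷_; map; length)
import Data.List.Properties as LP
open import Data.Product using (∃; _×_; _,_; proj₁; proj₂)
open import Data.Sum using (_⊎_; inj₁; inj₂)
open import Data.Empty using (⊥; ⊥-elim)
open import Relation.Binary using (Tri; tri<; tri≈; tri>)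
open import Relation.Nullary using (yes; no; ¬_)
open import Relation.Binary.PropositionalEquality
  using (_≡_; _≢_; refl; sym; trans; cong; cong₂; subst; module ≡-Reasoning)

y-p+p≡y : ∀ p y → y - p + p ≡ y
y-p+p≡y = solve-∀

offset-elim : ∀ p {P : ℤ → Set} → (∀ z → P (z + p)) → ∀ y → P y
offset-elim p {P} h y = subst P (y-p+p≡y p y) (h (y - p))

at : ℤ → (ℤ → ℤ) → ℤ → ℤ
at p f y = f (y - p) + p

at-offset : ∀ p f z → at p f (z + p) ≡ f z + p
at-offset p f z = cong (λ w → f w + p) (z+p-p≡z p z)
  where
  z+p-p≡z : ∀ p z → z + p - p ≡ z
  z+p-p≡z = solve-∀

at-translate : ∀ p c f y → at (p + c) f (y + c) ≡ at p f y + c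
at-translate p c f y =
  trans (cong (λ w → f w + (p + c)) (shift p c y)) (sym (ℤP.+-assoc (f (y - p)) p c))
  where
  shift : ∀ p c y → y + c - (p + c) ≡ y - p
  shift = solve-∀

at-involutive : ∀ f → (∀ z → f (f z) ≡ z) → ∀ p y → at p f (at p f y) ≡ y
at-involutive f f-inv p y = begin
  at p f (f (y - p) + p) ≡⟨ at-offset p f (f (y - p)) ⟩
  f (f (y - p)) + p      ≡⟨ cong (_+ p) (f-inv (y - p)) ⟩
  y - p + p              ≡⟨ y-p+p≡y p y ⟩
  y                      ∎
  where open ≡-Reasoning

FixesOutside : ℕ → (ℤ → ℤ) → Set
FixesOutside M f = ∀ z → z < 0ℤ ⊎ + M < z → f z ≡ z

at-fixes : ∀ {M f} → FixesOutside M f → ∀ p y → y < p ⊎ + M + p < y → at p f y ≡ y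
at-fixes {M} {f} fixes p y out = trans (cong (_+ p) (fixes (y - p) (shifted out))) (y-p+p≡y p y)
  where
  M+p-p≡M : ∀ M p → M + p - p ≡ M
  M+p-p≡M = solve-∀
  shifted : y < p ⊎ + M + p < y → y - p < 0ℤ ⊎ + M < y - p
  shifted (inj₁ y<p) = inj₁ (subst (y - p <_) (ℤP.+-inverseʳ p) (ℤP.+-monoˡ-< (- p) y<p))
  shifted (inj₂ M+p<y) = inj₂ (subst (_< y - p) (M+p-p≡M (+ M) p) (ℤP.+-monoˡ-< (- p) M+p<y))

swap₀ : ℤ → ℤ
swap₀ (+ 0) = + 1
swap₀ (+ 1) = + 0
swap₀ z     = z

swap₀-involutive : ∀ z → swap₀ (swap₀ z) ≡ z
swap₀-involutive (+ 0)           = refl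
swap₀-involutive (+ 1)           = refl
swap₀-involutive (+ suc (suc t)) = refl
swap₀-involutive -[1+ t ]        = refl

swap₀-fixesOutside : FixesOutside 1 swap₀
swap₀-fixesOutside -[1+ t ]        _                       = refl
swap₀-fixesOutside (+ suc (suc t)) _                       = refl
swap₀-fixesOutside (+ _)           (inj₁ (ℤ.+<+ ()))
swap₀-fixesOutside (+ 0)           (inj₂ (ℤ.+<+ ()))
swap₀-fixesOutside (+ 1)           (inj₂ (ℤ.+<+ (s≤s ())))

swap : ℤ → ℤ → ℤ
swap a = at a swap₀

swap-self : ∀ a → swap a a ≡ 1ℤ + a
swap-self a = trans (cong (swap a) (sym (ℤP.+-identityˡ a))) (at-offset a swap₀ 0ℤ)

swap-suc : ∀ a → swap a (1ℤ + a) ≡ a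
swap-suc a = trans (at-offset a swap₀ 1ℤ) (ℤP.+-identityˡ a)

swap-fixes : ∀ a y → y ≢ a → y ≢ 1ℤ + a → swap a y ≡ y
swap-fixes a = offset-elim a fixes
  where
  fixes : ∀ z → z + a ≢ a → z + a ≢ 1ℤ + a → swap a (z + a) ≡ z + a
  fixes (+ 0)             ≢a _    = ⊥-elim (≢a (ℤP.+-identityˡ a))
  fixes (+ 1)             _  ≢1+a = ⊥-elim (≢1+a refl)
  fixes z@(+ suc (suc _)) _  _    = at-offset a swap₀ z
  fixes z@(-[1+ _ ])      _  _    = at-offset a swap₀ z

swap-fixesOutside : ∀ a y → y < a ⊎ 1ℤ + a < y → swap a y ≡ y
swap-fixesOutside = at-fixes swap₀-fixesOutside

swap-involutive : ∀ a y → swap a (swap a y) ≡ y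
swap-involutive = at-involutive swap₀ swap₀-involutive

swap-up : ∀ a y → (y ≡ a × swap a y ≡ 1ℤ + y) ⊎ swap a y ≤ y
swap-up a = offset-elim a up
  where
  up : ∀ z → (z + a ≡ a × swap a (z + a) ≡ 1ℤ + (z + a)) ⊎ swap a (z + a) ≤ z + a
  up (+ 0)             = inj₁ (ℤP.+-identityˡ a
                              , trans (at-offset a swap₀ 0ℤ)
                                      (cong (λ w → 1ℤ + w) (sym (ℤP.+-identityˡ a))))
  up (+ 1)             = inj₂ (ℤP.≤-trans (ℤP.≤-reflexive (at-offset a swap₀ 1ℤ))
                                          (ℤP.+-monoˡ-≤ a (ℤ.+≤+ z≤n)))
  up z@(+ suc (suc _)) = inj₂ (ℤP.≤-reflexive (at-offset a swap₀ z))
  up z@(-[1+ _ ])      = inj₂ (ℤP.≤-reflexive (at-offset a swap₀ z))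

swap-down : ∀ a y → (y ≡ 1ℤ + a × 1ℤ + swap a y ≡ y) ⊎ y ≤ swap a y
swap-down a = offset-elim a down
  where
  down : ∀ z → (z + a ≡ 1ℤ + a × 1ℤ + swap a (z + a) ≡ z + a) ⊎ z + a ≤ swap a (z + a)
  down (+ 0)             = inj₂ (ℤP.≤-trans (ℤP.+-monoˡ-≤ a (ℤ.+≤+ z≤n))
                                            (ℤP.≤-reflexive (sym (at-offset a swap₀ 0ℤ))))
  down (+ 1)             = inj₁ (refl , cong (λ w → 1ℤ + w) (swap-suc a))
  down z@(+ suc (suc _)) = inj₂ (ℤP.≤-reflexive (sym (at-offset a swap₀ z)))
  down z@(-[1+ _ ])      = inj₂ (ℤP.≤-reflexive (sym (at-offset a swap₀ z)))

swap-≤ : ∀ a y → swap a y ≤ 1ℤ + y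
swap-≤ a y with swap-up a y
... | inj₁ (_ , up) = ℤP.≤-reflexive up
... | inj₂ ≤y       = ℤP.i≤j⇒i≤k+j 1ℤ ≤y

swap-≥ : ∀ a y → y ≤ 1ℤ + swap a y
swap-≥ a y with swap-down a y
... | inj₁ (_ , down) = ℤP.≤-reflexive (sym down)
... | inj₂ y≤         = ℤP.i≤j⇒i≤k+j 1ℤ y≤

M+x≰1+x : ∀ {M} → 2 ℕ.≤ M → ∀ x → ¬ (+ M + x ≤ 1ℤ + x)
M+x≰1+x 2≤M x = ℤP.<⇒≱ (ℤP.+-monoˡ-< x (ℤ.+<+ 2≤M))

swap∘swap≡M+x⇒a≡1+x : ∀ {M} → 2 ℕ.≤ M → ∀ a b x → swap a (swap b x) ≡ + M + x → a ≡ 1ℤ + x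
swap∘swap≡M+x⇒a≡1+x 2≤M a b x moved with swap-up b x
... | inj₂ b-stays = ⊥-elim (M+x≰1+x 2≤M x
        (ℤP.≤-trans (ℤP.≤-reflexive (sym moved))
          (ℤP.≤-trans (swap-≤ a (swap b x)) (ℤP.+-monoʳ-≤ 1ℤ b-stays))))
... | inj₁ (_ , b-up) with swap-up a (swap b x)
...   | inj₁ (at-a , _) = trans (sym at-a) b-up
...   | inj₂ a-stays    = ⊥-elim (M+x≰1+x 2≤M x
        (ℤP.≤-trans (ℤP.≤-reflexive (sym moved)) (ℤP.≤-trans a-stays (ℤP.≤-reflexive b-up))))

M+swap∘swap≡y⇒y≡1+a : ∀ {M} → 2 ℕ.≤ M → ∀ a b y → + M + swap b (swap a y) ≡ y → y ≡ 1ℤ + a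
M+swap∘swap≡y⇒y≡1+a 2≤M a b y moved with swap-down a y
... | inj₁ (at-1+a , _) = at-1+a
... | inj₂ a-stays      = ⊥-elim (M+x≰1+x 2≤M (swap b (swap a y))
        (ℤP.≤-trans (ℤP.≤-reflexive moved) (ℤP.≤-trans a-stays (swap-≥ b (swap a y)))))

reverse₀ : ℕ → ℤ → ℤ
reverse₀ M (+ t) with t ℕ.≤? M
... | yes _ = + (M ∸ t)
... | no _  = + t
reverse₀ M -[1+ t ] = -[1+ t ]

reverse₀-inside : ∀ M {t} → t ℕ.≤ M → reverse₀ M (+ t) ≡ + (M ∸ t)
reverse₀-inside M {t} t≤M with t ℕ.≤? M
... | yes _  = refl
... | no t≰M = ⊥-elim (t≰M t≤M)

reverse₀-fixesOutside : ∀ M → FixesOutside M (reverse₀ M)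
reverse₀-fixesOutside M -[1+ t ] _                 = refl
reverse₀-fixesOutside M (+ t)    (inj₁ (ℤ.+<+ ()))
reverse₀-fixesOutside M (+ t)    (inj₂ (ℤ.+<+ M<t)) with t ℕ.≤? M
... | yes t≤M = ⊥-elim (ℕP.<⇒≱ M<t t≤M)
... | no _    = refl

reverse₀-involutive : ∀ M z → reverse₀ M (reverse₀ M z) ≡ z
reverse₀-involutive M (+ t) with t ℕ.≤? M
... | yes t≤M = trans (reverse₀-inside M (ℕP.m∸n≤m M t)) (cong +_ (ℕP.m∸[m∸n]≡n t≤M))
... | no t≰M  = reverse₀-fixesOutside M (+ t) (inj₂ (ℤ.+<+ (ℕP.≰⇒> t≰M)))
reverse₀-involutive M -[1+ t ] = refl

reverse : ℕ → ℤ → ℤ → ℤ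
reverse M p = at p (reverse₀ M)

reverse-start : ∀ M p → reverse M p p ≡ + M + p
reverse-start M p = trans (cong (reverse M p) (sym (ℤP.+-identityˡ p))) (at-offset p (reverse₀ M) 0ℤ)

reverse-end : ∀ M p → reverse M p (+ M + p) ≡ p
reverse-end M p = begin
  reverse M p (+ M + p)  ≡⟨ at-offset p (reverse₀ M) (+ M) ⟩
  reverse₀ M (+ M) + p   ≡⟨ cong (_+ p) (reverse₀-inside M ℕP.≤-refl) ⟩
  + (M ∸ M) + p          ≡⟨ cong (λ t → + t + p) (ℕP.n∸n≡0 M) ⟩
  0ℤ + p                 ≡⟨ ℤP.+-identityˡ p ⟩
  p                      ∎
  where open ≡-Reasoning

reverse-fixes : ∀ M p y → y < p ⊎ + M + p < y → reverse M p y ≡ y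
reverse-fixes M = at-fixes (reverse₀-fixesOutside M)

reverse-involutive : ∀ M p y → reverse M p (reverse M p y) ≡ y
reverse-involutive M = at-involutive (reverse₀ M) (reverse₀-involutive M)

reverse-translate : ∀ M p c y → reverse M (p + c) (y + c) ≡ reverse M p y + c
reverse-translate M p c = at-translate p c (reverse₀ M)

involution-exchange : ∀ (f g h k : ℤ → ℤ) → (∀ y → f (f y) ≡ y) → (∀ y → k (k y) ≡ y)
                    → (∀ y → f (h y) ≡ g (k y)) → ∀ y → f (g y) ≡ h (k y)
involution-exchange f g h k f-inv k-inv fh≗gk y = begin
  f (g y)         ≡⟨ cong (λ w → f (g w)) (sym (k-inv y)) ⟩
  f (g (k (k y))) ≡⟨ cong f (sym (fh≗gk (k y))) ⟩
  f (f (h (k y))) ≡⟨ f-inv (h (k y)) ⟩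
  h (k y)         ∎
  where open ≡-Reasoning

swap∘swap-fixes⇒≡ : ∀ a b → swap a (swap b b) ≡ b → a ≡ b
swap∘swap-fixes⇒≡ a b fixed with swap-down a (1ℤ + b)
... | inj₁ (1+b≡1+a , _) = sym (∙-cancelˡ 1ℤ b a 1+b≡1+a)
... | inj₂ 1+b≤        = ⊥-elim (ℤP.<-irrefl refl (ℤP.suc[i]≤j⇒i<j
        (ℤP.≤-trans 1+b≤ (ℤP.≤-reflexive (trans (cong (swap a) (sym (swap-self b))) fixed)))))

reverse∘reverse≢swap∘swap : ∀ {M} → 2 ℕ.≤ M → ∀ {p q a b} → p < q
  → (∀ y → reverse M p (reverse M q y) ≡ swap a (swap b y))
  → (∀ y → reverse M q (reverse M p y) ≡ swap b (swap a y)) → ⊥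
reverse∘reverse≢swap∘swap {M} 2≤M {p} {q} {a} {b} p<q pq≗ab qp≗ba =
  ℤP.<-irrefl (sym M+q≡2+p) (ℤP.+-mono-≤-< (ℤ.+≤+ 2≤M) p<q)
  where
  open ≡-Reasoning
  a≡1+p : a ≡ 1ℤ + p
  a≡1+p = swap∘swap≡M+x⇒a≡1+x 2≤M a b p (begin
    swap a (swap b p)           ≡⟨ sym (pq≗ab p) ⟩
    reverse M p (reverse M q p) ≡⟨ cong (reverse M p) (reverse-fixes M q p (inj₁ p<q)) ⟩
    reverse M p p               ≡⟨ reverse-start M p ⟩
    + M + p                     ∎)
  M+q≡1+a : + M + q ≡ 1ℤ + a
  M+q≡1+a = M+swap∘swap≡y⇒y≡1+a 2≤M a b (+ M + q) (cong (λ w → + M + w) (begin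
    swap b (swap a (+ M + q))           ≡⟨ sym (qp≗ba (+ M + q)) ⟩
    reverse M q (reverse M p (+ M + q)) ≡⟨ cong (reverse M q)
                                             (reverse-fixes M p _ (inj₂ (ℤP.+-monoʳ-< (+ M) p<q))) ⟩
    reverse M q (+ M + q)               ≡⟨ reverse-end M q ⟩
    q                                   ∎))
  M+q≡2+p : + M + q ≡ + 2 + p
  M+q≡2+p = trans M+q≡1+a (trans (cong (λ w → 1ℤ + w) a≡1+p) (sym (ℤP.+-assoc 1ℤ 1ℤ p)))

reverse∘swap-injective : ∀ {M} → 2 ℕ.≤ M → ∀ {p q a b}
  → (∀ y → reverse M p (swap a y) ≡ reverse M q (swap b y)) → a ≡ b
reverse∘swap-injective {M} 2≤M {p} {q} {a} {b} pa≗qb = by-order (ℤP.<-cmp p q)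
  where
  pq≗ab : ∀ y → reverse M p (reverse M q y) ≡ swap a (swap b y)
  pq≗ab = involution-exchange (reverse M p) (reverse M q) (swap a) (swap b)
          (reverse-involutive M p) (swap-involutive b) pa≗qb
  qp≗ba : ∀ y → reverse M q (reverse M p y) ≡ swap b (swap a y)
  qp≗ba = involution-exchange (reverse M q) (reverse M p) (swap b) (swap a)
          (reverse-involutive M q) (swap-involutive a) (λ y → sym (pa≗qb y))
  by-order : Tri (p < q) (p ≡ q) (q < p) → a ≡ b
  by-order (tri< p<q _ _) = ⊥-elim (reverse∘reverse≢swap∘swap 2≤M p<q pq≗ab qp≗ba)
  by-order (tri> _ _ q<p) = ⊥-elim (reverse∘reverse≢swap∘swap 2≤M q<p qp≗ba pq≗ab)
  by-order (tri≈ _ refl _) = swap∘swap-fixes⇒≡ a b (trans (sym (pq≗ab b)) (reverse-involutive M p b))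

lift : ∀ {n} → Fun n → ℤ → ℤ
lift {n} τ (+ t) with t ℕ.<? n
... | yes t<n = + toℕ (τ (fromℕ< t<n))
... | no _    = + t
lift τ -[1+ t ] = -[1+ t ]

Outside : ℕ → ℤ → Set
Outside n y = y < 0ℤ ⊎ + n ≤ y

outside-beyond : ∀ {n} M p {y} → M ℕ.+ p ℕ.< n → Outside n y → y < + p ⊎ + M + + p < y
outside-beyond M p _     (inj₁ y<0) = inj₁ (ℤP.<-≤-trans y<0 (ℤ.+≤+ z≤n))
outside-beyond M p M+p<n (inj₂ n≤y) = inj₂ (ℤP.<-≤-trans (ℤ.+<+ M+p<n) n≤y)

lift-toℕ : ∀ {n} (τ : Fun n) x → lift τ (+ toℕ x) ≡ + toℕ (τ x)
lift-toℕ {n} τ x with toℕ x ℕ.<? n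
... | yes x<n = cong (λ x′ → + toℕ (τ x′)) (FP.fromℕ<-toℕ x x<n)
... | no x≮n  = ⊥-elim (x≮n (FP.toℕ<n x))

lift-outside : ∀ {n} (τ : Fun n) y → Outside n y → lift τ y ≡ y
lift-outside τ -[1+ t ] _                     = refl
lift-outside τ (+ t)    (inj₁ (ℤ.+<+ ()))
lift-outside {n} τ (+ t) (inj₂ (ℤ.+≤+ n≤t)) with t ℕ.<? n
... | yes t<n = ⊥-elim (ℕP.<⇒≱ t<n n≤t)
... | no _    = refl

lift-unique : ∀ {n} (τ : Fun n) (g : ℤ → ℤ) → (∀ x → g (+ toℕ x) ≡ + toℕ (τ x))
            → (∀ y → Outside n y → g y ≡ y) → ∀ y → lift τ y ≡ g y
lift-unique {n} τ g inside outside (+ t) with t ℕ.<? n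
... | yes t<n = sym (trans (cong (λ t′ → g (+ t′)) (sym (FP.toℕ-fromℕ< t<n))) (inside (fromℕ< t<n)))
... | no t≮n  = sym (outside (+ t) (inj₂ (ℤ.+≤+ (ℕP.≮⇒≥ t≮n))))
lift-unique τ g inside outside -[1+ t ] = sym (outside -[1+ t ] (inj₁ ℤ.-<+))

lift-∘ : ∀ {n} (σ τ : Fun n) y → lift (σ · τ) y ≡ lift σ (lift τ y)
lift-∘ σ τ = lift-unique (σ · τ) (λ y → lift σ (lift τ y))
  (λ x → trans (cong (lift σ) (lift-toℕ τ x)) (lift-toℕ σ (τ x)))
  (λ y out → trans (cong (lift σ) (lift-outside τ y out)) (lift-outside σ y out))

lift-cong : ∀ {n} {σ τ : Fun n} → σ ≈ τ → ∀ y → lift σ y ≡ lift τ y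
lift-cong {σ = σ} {τ} σ≈τ = lift-unique σ (lift τ)
  (λ x → trans (lift-toℕ τ x) (cong (λ w → + toℕ w) (sym (σ≈τ x))))
  (lift-outside τ)

toℕ-s : ∀ {m} (j : Fin m) x → + toℕ (s j x) ≡ swap (+ toℕ j) (+ toℕ x)
toℕ-s j x with x FP.≟ inject₁ j
... | yes refl rewrite FP.toℕ-inject₁ j = sym (swap-self (+ toℕ j))
... | no x≢j with x FP.≟ F.suc j
...   | yes refl rewrite FP.toℕ-inject₁ j = sym (swap-suc (+ toℕ j))
...   | no x≢1+j = sym (swap-fixes (+ toℕ j) (+ toℕ x)
          (λ e → x≢j (FP.toℕ-injective (trans (ℤP.+-injective e) (sym (FP.toℕ-inject₁ j)))))
          (λ e → x≢1+j (FP.toℕ-injective (ℤP.+-injective e))))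

lift-s : ∀ {m} (j : Fin m) y → lift (s j) y ≡ swap (+ toℕ j) y
lift-s j = lift-unique (s j) (swap (+ toℕ j)) (λ x → sym (toℕ-s j x))
  (λ y out → swap-fixesOutside (+ toℕ j) y (outside-beyond 1 (toℕ j) (s≤s (FP.toℕ<n j)) out))

word : List ℤ → ℤ → ℤ
word []      y = y
word (a ∷ w) y = swap a (word w y)

word-translate : ∀ c ws y → word (map (_+ c) ws) (y + c) ≡ word ws y + c
word-translate c []       y = refl
word-translate c (a ∷ ws) y =
  trans (cong (swap (a + c)) (word-translate c ws y)) (at-translate a c swap₀ (word ws y))

lift-prod : ∀ {m} (w : List (Fin m)) y → lift (prod {suc m} w) y ≡ word (map +_ (map toℕ w)) y
lift-prod {m} [] = lift-unique (prod {suc m} []) (λ y → y) (λ _ → refl) (λ _ _ → refl)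
lift-prod (i ∷ w) y = begin
  lift (s i · prod w) y              ≡⟨ lift-∘ (s i) (prod w) y ⟩
  lift (s i) (lift (prod w) y)       ≡⟨ lift-s i (lift (prod w) y) ⟩
  swap (+ toℕ i) (lift (prod w) y)   ≡⟨ cong (swap (+ toℕ i)) (lift-prod w y) ⟩
  word (map +_ (map toℕ (i ∷ w))) y  ∎
  where open ≡-Reasoning

a+suc[M]≡suc[M+a] : ∀ a M → a ℕ.+ suc M ≡ suc (M ℕ.+ a)
a+suc[M]≡suc[M+a] a M = trans (ℕP.+-suc a M) (cong suc (ℕP.+-comm a M))

toℕ-w0 : ∀ {n} M a x → a ℕ.+ suc M ℕ.≤ n → + toℕ (w0 {n} (suc M) a x) ≡ reverse M (+ a) (+ toℕ x)
toℕ-w0 {n} M a x bound with a ℕ.≤? toℕ x | toℕ x ℕ.<? a ℕ.+ suc M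
... | yes a≤x | yes x<a+k with (a ℕ.+ (suc M ∸ 1) ∸ (toℕ x ∸ a)) ℕ.<? n
...   | yes r<n = begin
  + toℕ (fromℕ< r<n)                ≡⟨ cong +_ (FP.toℕ-fromℕ< r<n) ⟩
  + (a ℕ.+ M ∸ (toℕ x ∸ a))         ≡⟨ cong +_ (ℕP.+-∸-assoc a d≤M) ⟩
  + (a ℕ.+ (M ∸ (toℕ x ∸ a)))       ≡⟨ cong +_ (ℕP.+-comm a _) ⟩
  + (M ∸ (toℕ x ∸ a)) + + a         ≡⟨ cong (_+ + a) (sym (reverse₀-inside M d≤M)) ⟩
  reverse₀ M (+ (toℕ x ∸ a)) + + a  ≡⟨ cong (λ z → reverse₀ M z + + a) (sym x-a≡d) ⟩
  reverse M (+ a) (+ toℕ x)         ∎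
  where
  open ≡-Reasoning
  d≤M : toℕ x ∸ a ℕ.≤ M
  d≤M = ℕP.≤-pred (ℕP.m<n+o⇒m∸n<o (toℕ x) a x<a+k)
  x-a≡d : + toℕ x - + a ≡ + (toℕ x ∸ a)
  x-a≡d = trans (ℤP.m-n≡m⊖n (toℕ x) a) (ℤP.⊖-≥ a≤x)
...   | no r≮n = ⊥-elim (r≮n (ℕP.≤-<-trans (ℕP.m∸n≤m (a ℕ.+ M) (toℕ x ∸ a))
                                          (ℕP.<-≤-trans (ℕP.+-monoʳ-< a (ℕP.n<1+n M)) bound)))
toℕ-w0 M a x bound | yes _ | no x≮a+k =
  sym (reverse-fixes M (+ a) (+ toℕ x)
    (inj₂ (ℤ.+<+ (subst (ℕ._≤ toℕ x) (a+suc[M]≡suc[M+a] a M) (ℕP.≮⇒≥ x≮a+k)))))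
toℕ-w0 M a x bound | no a≰x | _ =
  sym (reverse-fixes M (+ a) (+ toℕ x) (inj₁ (ℤ.+<+ (ℕP.≰⇒> a≰x))))

lift-w0 : ∀ {n} M a → a ℕ.+ suc M ℕ.≤ n → ∀ y → lift (w0 {n} (suc M) a) y ≡ reverse M (+ a) y
lift-w0 {n} M a bound = lift-unique (w0 (suc M) a) (reverse M (+ a))
  (λ x → sym (toℕ-w0 M a x bound))
  (λ y out → reverse-fixes M (+ a) y
    (outside-beyond M a (subst (ℕ._≤ n) (a+suc[M]≡suc[M+a] a M) bound) out))

x≡y+[x-y] : ∀ x y → x ≡ y + (x - y)
x≡y+[x-y] = solve-∀

sub-exchange : ∀ a b c d → a - b ≡ c - d → b - d ≡ a - c
sub-exchange a b c d a-b≡c-d = begin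
  b - d                         ≡⟨ regroup a b c d ⟩
  a - c - (a - b - (c - d))     ≡⟨ cong (λ w → a - c - (w - (c - d))) a-b≡c-d ⟩
  a - c - (c - d - (c - d))     ≡⟨ cancel (a - c) (c - d) ⟩
  a - c                         ∎
  where
  open ≡-Reasoning
  regroup : ∀ a b c d → b - d ≡ a - c - (a - b - (c - d))
  regroup = solve-∀
  cancel : ∀ u v → u - (v - v) ≡ u
  cancel = solve-∀

same-diffs⇒shift-by-head : ∀ x y xs ys → length xs ≡ length ys → diffs (x ∷ xs) ≡ diffs (y ∷ ys)
                          → map +_ (x ∷ xs) ≡ map (_+ (+ x - + y)) (map +_ (y ∷ ys))
same-diffs⇒shift-by-head x y []        []        _ _ = cong (_∷ []) (x≡y+[x-y] (+ x) (+ y))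
same-diffs⇒shift-by-head x y (x′ ∷ xs) (y′ ∷ ys) |xs|≡|ys| diffs≡ with LP.∷-injective diffs≡
... | head≡ , tail≡ = cong₂ _∷_ (x≡y+[x-y] (+ x) (+ y))
  (trans (same-diffs⇒shift-by-head x′ y′ xs ys (ℕP.suc-injective |xs|≡|ys|) tail≡)
         (cong (λ c → map (_+ c) (map +_ (y′ ∷ ys))) (sub-exchange (+ x) (+ x′) (+ y) (+ y′) head≡)))
same-diffs⇒shift-by-head x y []        (_ ∷ _)   ()
same-diffs⇒shift-by-head x y (_ ∷ _)   []        ()

same-diffs⇒shift : ∀ xs ys → length xs ≡ length ys → diffs xs ≡ diffs ys
                  → ∃ λ c → map +_ xs ≡ map (_+ c) (map +_ ys)
same-diffs⇒shift []       []       _ _ = 0ℤ , refl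
same-diffs⇒shift (x ∷ xs) (y ∷ ys) |xs|≡|ys| diffs≡ =
  + x - + y , same-diffs⇒shift-by-head x y xs ys (ℕP.suc-injective |xs|≡|ys|) diffs≡

equivalent-w0⇒reversal : ∀ {m} M (τ : Fun (suc m)) → EquivSomeW0 (suc M) τ
                       → ∃ λ p → ∀ y → lift τ y ≡ reverse M p y
equivalent-w0⇒reversal {m} M τ (a , bound , ℓτ≡ℓw , u , v , (u≈τ , |u|≡ℓτ) , (v≈w , |v|≡ℓw) , diffs≡) =
  + a + c , λ y → begin
    lift τ y                          ≡⟨ lift-cong (λ x → sym (u≈τ x)) y ⟩
    lift (prod u) y                   ≡⟨ lift-prod u y ⟩
    word (map +_ (map toℕ u)) y       ≡⟨ cong₂ word u≡v+c (sym (y-p+p≡y c y)) ⟩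
    word (map (_+ c) V) (y - c + c)   ≡⟨ word-translate c V (y - c) ⟩
    word V (y - c) + c                ≡⟨ cong (_+ c) (sym (lift-prod v (y - c))) ⟩
    lift (prod v) (y - c) + c         ≡⟨ cong (_+ c) (lift-cong v≈w (y - c)) ⟩
    lift (w0 (suc M) a) (y - c) + c   ≡⟨ cong (_+ c) (lift-w0 M a bound (y - c)) ⟩
    reverse M (+ a) (y - c) + c       ≡⟨ sym (reverse-translate M (+ a) c (y - c)) ⟩
    reverse M (+ a + c) (y - c + c)   ≡⟨ cong (reverse M (+ a + c)) (y-p+p≡y c y) ⟩
    reverse M (+ a + c) y             ∎
  where
  open ≡-Reasoning
  V : List ℤ
  V = map +_ (map toℕ v)
  |u|≡|v| : length (map toℕ u) ≡ length (map toℕ v)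
  |u|≡|v| = begin
    length (map toℕ u)              ≡⟨ LP.length-map toℕ u ⟩
    length u                        ≡⟨ trans |u|≡ℓτ ℓτ≡ℓw ⟩
    ℓ (w0 {suc m} (suc M) a)        ≡⟨ |v|≡ℓw ⟨
    length v                        ≡⟨ LP.length-map toℕ v ⟨
    length (map toℕ v)              ∎
  shift : ∃ λ c → map +_ (map toℕ u) ≡ map (_+ c) V
  shift = same-diffs⇒shift (map toℕ u) (map toℕ v) |u|≡|v| diffs≡
  c : ℤ
  c = proj₁ shift
  u≡v+c : map +_ (map toℕ u) ≡ map (_+ c) V
  u≡v+c = proj₂ shift

lift-·s : ∀ {m} (σ : Fun (suc m)) j {f : ℤ → ℤ} → (∀ y → lift (σ · s j) y ≡ f y)
        → ∀ y → lift σ y ≡ f (swap (+ toℕ j) y)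
lift-·s σ j {f} σs≗f y = begin
  lift σ y                         ≡⟨ cong (lift σ) (swap-involutive jℤ y) ⟨
  lift σ (swap jℤ (swap jℤ y))     ≡⟨ cong (lift σ) (lift-s j (swap jℤ y)) ⟨
  lift σ (lift (s j) (swap jℤ y))  ≡⟨ lift-∘ σ (s j) (swap jℤ y) ⟨
  lift (σ · s j) (swap jℤ y)       ≡⟨ σs≗f (swap jℤ y) ⟩
  f (swap jℤ y)                    ∎
  where
  open ≡-Reasoning
  jℤ : ℤ
  jℤ = + toℕ j

s-reversals⇒≡ : ∀ {m M} → 2 ℕ.≤ M → (σ : Fun (suc m)) (j j′ : Fin m)
  → (∃ λ p → ∀ y → lift (σ · s j) y ≡ reverse M p y)
  → (∃ λ q → ∀ y → lift (σ · s j′) y ≡ reverse M q y)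
  → j ≡ j′
s-reversals⇒≡ 2≤M σ j j′ (p , σsj≗p) (q , σsj′≗q) =
  FP.toℕ-injective (ℤP.+-injective (reverse∘swap-injective 2≤M
    (λ y → trans (sym (lift-·s σ j σsj≗p y)) (lift-·s σ j′ σsj′≗q y))))

-- Only the two equivalences and k > 2 are needed; the other hypotheses are unused.
proposition3p3 : (k n : ℕ) → 2 ℕ.< k → (σ : Fin n → Fin n) → IsPerm σ
    → ¬ EquivSomeW0 k σ
    → ((π : Fin n → Fin n) → EquivSomeW0 k π → ¬ CoveredBy σ π)
    → (j j′ : Letter n) → Des σ j → Des σ j′
    → EquivSomeW0 k (σ · s j) → EquivSomeW0 k (σ · s j′)
    → j ≡ j′
proposition3p3 zero    _       ()
proposition3p3 (suc M) zero    _ _ _ _ _ ()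
proposition3p3 (suc M) (suc m) (s≤s 2≤M) σ _ _ _ j j′ _ _ σsj≃w0 σsj′≃w0 =
  s-reversals⇒≡ 2≤M σ j j′
    (equivalent-w0⇒reversal M (σ · s j) σsj≃w0)
    (equivalent-w0⇒reversal M (σ · s j′) σsj′≃w0)
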